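{- For every integer $k\ge 2$, let $S_k$ be the star with $k$ leaves. Then $wp(S_k)=p(S_k)=k+2$.
   Context: A configuration of pebbles on a graph $G$ is a function $C:V(G)\to\mathbb{N}$; its size is $\sum_v C(v)$. A weight distribution $W$ on $G$ assigns to each edge $e$ a weight $w_e\in[0,1]$; $|W|=\sum_e w_e$, and $G_W$ is the weighted graph. A pebbling step along an edge $uv$ of weight $w$ removes $k$ pebbles from $u$ (positive integer $k$ not exceeding the number on $u$) and adds $\lfloor wk\rfloor$ pebbles to $v$. A target $t$ can be reached from $C$ if some sequence of pebbling steps yields at least one pebble on $t$. $G_W$ is $p$-solvable if every configuration of $p$ pebbles can reach every target vertex. The weighted pebbling number $wp(G)$ is the smallest positive integer $p$ for which there is a weight distribution $W$ with $|W|=|E(G)|/2$ such that $G_W$ is $p$-solvable. The (ordinary) pebbling number $p(G)$ is the smallest integer $m$ such that every configuration of size $m$ can reach every target, where an ordinary pebbling step along an edge $uv$ removes $2$ pebbles from $u$ and adds $1$ pebble to $v$.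
   Formalization: The edge weights $w_e$ of every weight distribution $W$ are rational numbers in [0,1]. -}

module Defs where

open import Data.Nat as ℕ using (ℕ; zero; suc; _≤_; _<_)
open import Data.Fin using (Fin; zero; suc; _≟_)
open import Data.Integer as ℤ using (+_)
open import Data.Rational as ℚ using (ℚ; 0ℚ; floor)
open import Data.Product using (Σ; _×_; _,_; proj₁; proj₂; ∃-syntax)
open import Data.Sum using (_⊎_)
open import Relation.Binary.PropositionalEquality using (_≡_)
open import Relation.Nullary using (¬_; yes; no)
open import Relation.Binary.Construct.Closure.ReflexiveTransitive using (Star)

record Graph : Set where
  field
    n   : ℕ
    m   : ℕ
    ends : Fin m → Fin n × Fin n

open Graph public

-- The star S_k with k leaves: vertex 0 is the centre, vertices 1..k the
-- leaves; edge i joins the centre to leaf (suc i).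
StarGraph : ℕ → Graph
StarGraph k = record { n = suc k ; m = k ; ends = λ i → (zero , suc i) }

sumℕ : (n : ℕ) → (Fin n → ℕ) → ℕ
sumℕ zero    f = 0
sumℕ (suc n) f = f zero ℕ.+ sumℕ n (λ i → f (suc i))

sumℚ : (n : ℕ) → (Fin n → ℚ) → ℚ
sumℚ zero    f = 0ℚ
sumℚ (suc n) f = f zero ℚ.+ sumℚ n (λ i → f (suc i))

Config : Graph → Set
Config G = Fin (n G) → ℕ

size : (G : Graph) → Config G → ℕ
size G C = sumℕ (n G) C

-- C' is C with a pebbles removed from u and b pebbles added to v
-- (u ≠ v for edges of a simple graph; we do the removal first, then the addition).
update : (G : Graph) → Config G → Fin (n G) → ℕ → Fin (n G) → ℕ → Config G
update G C u a v b x with x ≟ v | x ≟ u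
... | yes _ | yes _ = (C x ℕ.∸ a) ℕ.+ b
... | yes _ | no _  = C x ℕ.+ b
... | no _  | yes _ = C x ℕ.∸ a
... | no _  | no _  = C x

Along : (G : Graph) → Fin (m G) → Fin (n G) → Fin (n G) → Set
Along G e u v = (proj₁ (ends G e) ≡ u × proj₂ (ends G e) ≡ v)
              ⊎ (proj₁ (ends G e) ≡ v × proj₂ (ends G e) ≡ u)

WeightDist : Graph → Set
WeightDist G = Fin (m G) → ℚ

∣_∣W : {G : Graph} → WeightDist G → ℚ
∣_∣W {G} W = sumℚ (m G) W

ValidWeight : (G : Graph) → WeightDist G → Set
ValidWeight G W =
  ((e : Fin (m G)) → (0ℚ ℚ.≤ W e) × (W e ℚ.≤ ℚ.1ℚ))
  × (∣_∣W {G} W ≡ (+ m G) ℚ./ 2)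

-- ⌊ w k ⌋ (as a natural number; nonnegative since w ≥ 0)
floorMul : ℚ → ℕ → ℕ
floorMul w k = ℤ.∣ floor (w ℚ.* ((+ k) ℚ./ 1)) ∣

data WStep (G : Graph) (W : WeightDist G) (C : Config G) : Config G → Set where
  wstep : (e : Fin (m G)) (u v : Fin (n G)) → Along G e u v →
          (k : ℕ) → 1 ≤ k → k ≤ C u →
          WStep G W C (update G C u k v (floorMul (W e) k))

WReaches : (G : Graph) → WeightDist G → Config G → Config G → Set
WReaches G W = Star (WStep G W)

WCanReach : (G : Graph) → WeightDist G → Config G → Fin (n G) → Set
WCanReach G W C t = ∃[ C' ] (WReaches G W C C' × 1 ≤ C' t)

WSolvable : (G : Graph) → WeightDist G → ℕ → Set
WSolvable G W p = (C : Config G) → size G C ≡ p → (t : Fin (n G)) → WCanReach G W C t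

WeightedSolvable : Graph → ℕ → Set
WeightedSolvable G p = ∃[ W ] (ValidWeight G W × WSolvable G W p)

IsWeightedPebblingNumber : Graph → ℕ → Set
IsWeightedPebblingNumber G p =
  1 ≤ p × WeightedSolvable G p × ((q : ℕ) → 1 ≤ q → q < p → ¬ WeightedSolvable G q)

data OStep (G : Graph) (C : Config G) : Config G → Set where
  ostep : (e : Fin (m G)) (u v : Fin (n G)) → Along G e u v →
          2 ≤ C u → OStep G C (update G C u 2 v 1)

OCanReach : (G : Graph) → Config G → Fin (n G) → Set
OCanReach G C t = ∃[ C' ] (Star (OStep G) C C' × 1 ≤ C' t)

OSolvable : Graph → ℕ → Set
OSolvable G p = (C : Config G) → size G C ≡ p → (t : Fin (n G)) → OCanReach G C t

IsPebblingNumber : Graph → ℕ → Set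
IsPebblingNumber G p = OSolvable G p × ((q : ℕ) → q < p → ¬ OSolvable G q)

module Submission where

-- Among k + 2 pebbles some leaf holds two, or the centre does;
-- a short case analysis (pigeonhole on the leaves) reaches every vertex by
-- ordinary moves.  An ordinary move is a weighted move of two pebbles along
-- an edge of weight ½, so the uniform weighting ½ is (k + 2)-solvable too.
--
-- Lower bounds, for q ≤ k + 1 pebbles.  All are instances of one principle
-- (unsolvable-below): an invariant preserved by moves, keeping the target
-- empty and holding below a capacity profile whose total is at least q.
--  * Ordinary moves, or weight ½ everywhere: three pebbles on one leaf s,
--    one on every leaf but the target leaf t.  Moves here are lossy (they
--    deliver at most one pebble, paying two for it); after s feeds the centre
--    no vertex holds two pebbles any more (module Blocking).
--  * A weighting of total k/2 that is not uniformly ½ has a light edge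
--    (weight < ½).  Putting on every leaf its edge's capacity (the largest
--    count whose transfers deliver nothing) keeps the centre empty, and
--    2 ≤ capacity(w) + 2w, strictly for light w, gives total capacity > k
--    (module Capping).

open import Defs
open import Data.Nat using (ℕ; _≤_; _+_)
open import Data.Product using (_×_)

open import Data.Nat as ℕ using (zero; suc; _*_; _∸_; _⊓_; _<_; z≤n; s≤s; _≤?_)
import Data.Nat.Properties as ℕP
import Data.Nat.DivMod as ℕD
import Data.Nat.Coprimality as Coprime
open import Data.Integer as ℤ using (+_; -[1+_])
import Data.Integer.Properties as ℤP
open import Data.Integer.Tactic.RingSolver using (solve-∀)
open import Data.Rational as ℚ using (ℚ; mkℚ; 0ℚ; 1ℚ; ½; toℚᵘ; *<*; *≤*)
import Data.Rational.Properties as ℚP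
open import Data.Rational.Solver using (module +-*-Solver)
open import Data.Rational.Unnormalised using (mkℚᵘ; *≡*)
  renaming (_≃_ to _≃ᵘ_; _+_ to _+ᵘ_)
import Data.Rational.Unnormalised.Properties as ℚᵘP
open import Data.Fin using (Fin; zero; suc; _≟_; punchIn)
import Data.Fin.Properties as FinP
open import Data.Product using (∃; ∃₂; _,_; proj₁)
open import Data.Sum using (_⊎_; inj₁; inj₂)
open import Data.Empty using (⊥-elim)
open import Function using (_∘_; id)
open import Relation.Nullary using (¬_; yes; no)
open import Relation.Binary.PropositionalEquality
open import Relation.Binary.Construct.Closure.ReflexiveTransitive using (Star; ε; _◅_; fold; map)

-- The embedding ℕ → ℚ in the form n/1 used by floorMul.
ofℕ : ℕ → ℚ
ofℕ n = + n ℚ./ 1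

fraction-sum : ∀ m d n e r f → mkℚᵘ m d +ᵘ mkℚᵘ n e ≃ᵘ mkℚᵘ r f →
               m ℚ./ suc d ℚ.+ n ℚ./ suc e ≡ r ℚ./ suc f
fraction-sum m d n e r f eq = ℚP.toℚᵘ-injective (begin
  toℚᵘ (m ℚ./ suc d ℚ.+ n ℚ./ suc e)         ≈⟨ ℚP.toℚᵘ-homo-+ (m ℚ./ suc d) (n ℚ./ suc e) ⟩
  toℚᵘ (m ℚ./ suc d) +ᵘ toℚᵘ (n ℚ./ suc e)   ≈⟨ ℚᵘP.+-cong (ℚP.toℚᵘ-fromℚᵘ (mkℚᵘ m d))
                                                            (ℚP.toℚᵘ-fromℚᵘ (mkℚᵘ n e)) ⟩
  mkℚᵘ m d +ᵘ mkℚᵘ n e                       ≈⟨ eq ⟩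
  mkℚᵘ r f                                   ≈⟨ ℚP.toℚᵘ-fromℚᵘ (mkℚᵘ r f) ⟨
  toℚᵘ (r ℚ./ suc f)                         ∎)
  where open ℚᵘP.≃-Reasoning

ofℕ-+ : ∀ a b → ofℕ (a + b) ≡ ofℕ a ℚ.+ ofℕ b
ofℕ-+ a b = sym (fraction-sum (+ a) 0 (+ b) 0 (+ (a + b)) 0
  (*≡* (trans (cross (+ a) (+ b)) (cong (ℤ._* + 1) (sym (ℤP.pos-+ a b))))))
  where
  cross : ∀ x y → (x ℤ.* + 1 ℤ.+ y ℤ.* + 1) ℤ.* + 1 ≡ (x ℤ.+ y) ℤ.* + 1
  cross = solve-∀

half+half : ∀ k → + k ℚ./ 2 ℚ.+ + k ℚ./ 2 ≡ ofℕ k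
half+half k = fraction-sum (+ k) 1 (+ k) 1 (+ k) 0 (*≡* (cross (+ k)))
  where
  cross : ∀ x → (x ℤ.* + 2 ℤ.+ x ℤ.* + 2) ℤ.* + 1 ≡ x ℤ.* + 4
  cross = solve-∀

½+half : ∀ k → ½ ℚ.+ + k ℚ./ 2 ≡ + suc k ℚ./ 2
½+half k = fraction-sum (+ 1) 1 (+ k) 1 (+ suc k) 1 (*≡* (cross (+ k)))
  where
  cross : ∀ x → (+ 1 ℤ.* + 2 ℤ.+ x ℤ.* + 2) ℤ.* + 2 ≡ (+ 1 ℤ.+ x) ℤ.* + 4
  cross = solve-∀

-- ofℕ a is already in normal form, which makes its order computable.
ofℕ-normal : ∀ a → ofℕ a ≡ mkℚ (+ a) 0 (Coprime.sym (Coprime.1-coprimeTo a))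
ofℕ-normal a = ℚP.↥p/↧p≡p (mkℚ (+ a) 0 (Coprime.sym (Coprime.1-coprimeTo a)))

ofℕ-mono-≤ : ∀ {a b} → a ≤ b → ofℕ a ℚ.≤ ofℕ b
ofℕ-mono-≤ {a} {b} a≤b rewrite ofℕ-normal a | ofℕ-normal b =
  *≤* (subst₂ ℤ._≤_ (sym (ℤP.*-identityʳ (+ a))) (sym (ℤP.*-identityʳ (+ b))) (ℤ.+≤+ a≤b))

ofℕ-cancel-< : ∀ {a b} → ofℕ a ℚ.< ofℕ b → a < b
ofℕ-cancel-< {a} {b} a<b rewrite ofℕ-normal a | ofℕ-normal b with a<b
... | *<* lt = ℤP.drop‿+<+ (subst₂ ℤ._<_ (ℤP.*-identityʳ (+ a)) (ℤP.*-identityʳ (+ b)) lt)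

floor-fraction : ∀ p → 0ℚ ℚ.≤ p → p ℚ.< 1ℚ → ℤ.∣ ℚ.floor p ∣ ≡ 0
floor-fraction (mkℚ (+ n) d c) _ (*<* n<d) = floor-zero
  where
  n<1+d : n < suc d
  n<1+d = ℤP.drop‿+<+ (subst₂ ℤ._<_ (ℤP.*-identityʳ (+ n)) (ℤP.*-identityˡ (+ suc d)) n<d)
  floor-zero : ℤ.∣ ℚ.floor (mkℚ (+ n) d c) ∣ ≡ 0
  floor-zero rewrite ℕD.m<n⇒m/n≡0 n<1+d = refl
floor-fraction (mkℚ -[1+ n ] d _) (*≤* ()) _

floorMul-small : ∀ w a → 0ℚ ℚ.≤ w → w ℚ.* ofℕ a ℚ.< 1ℚ → floorMul w a ≡ 0
floorMul-small w a 0≤w wa<1 = floor-fraction (w ℚ.* ofℕ a) 0≤wa wa<1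
  where
  0≤wa : 0ℚ ℚ.≤ w ℚ.* ofℕ a
  0≤wa = ℚP.nonNegative⁻¹ _ {{ℚP.nonNeg*nonNeg⇒nonNeg w {{ℚ.nonNegative 0≤w}}
                                (ofℕ a) {{ℚ.nonNegative (ofℕ-mono-≤ {0} {a} z≤n)}}}}

sumℕ-const : ∀ n c → sumℕ n (λ _ → c) ≡ n * c
sumℕ-const zero    c = refl
sumℕ-const (suc n) c = cong (c ℕ.+_) (sumℕ-const n c)

sumℚ-mono-≤ : ∀ n (f g : Fin n → ℚ) → (∀ i → f i ℚ.≤ g i) → sumℚ n f ℚ.≤ sumℚ n g
sumℚ-mono-≤ zero    f g f≤g = ℚP.≤-refl
sumℚ-mono-≤ (suc n) f g f≤g =
  ℚP.+-mono-≤ (f≤g zero) (sumℚ-mono-≤ n (f ∘ suc) (g ∘ suc) (f≤g ∘ suc))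

sumℚ-mono-< : ∀ n (f g : Fin n → ℚ) → (∀ i → f i ℚ.≤ g i) →
              (j : Fin n) → f j ℚ.< g j → sumℚ n f ℚ.< sumℚ n g
sumℚ-mono-< (suc n) f g f≤g zero    fj<gj =
  ℚP.+-mono-<-≤ fj<gj (sumℚ-mono-≤ n (f ∘ suc) (g ∘ suc) (f≤g ∘ suc))
sumℚ-mono-< (suc n) f g f≤g (suc j) fj<gj =
  ℚP.+-mono-≤-< (f≤g zero) (sumℚ-mono-< n (f ∘ suc) (g ∘ suc) (f≤g ∘ suc) j fj<gj)

sumℚ-+ : ∀ n (f g : Fin n → ℚ) → sumℚ n (λ i → f i ℚ.+ g i) ≡ sumℚ n f ℚ.+ sumℚ n g
sumℚ-+ zero    f g = refl
sumℚ-+ (suc n) f g = begin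
  (f zero ℚ.+ g zero) ℚ.+ sumℚ n (λ i → f (suc i) ℚ.+ g (suc i))
    ≡⟨ cong ((f zero ℚ.+ g zero) ℚ.+_) (sumℚ-+ n (f ∘ suc) (g ∘ suc)) ⟩
  (f zero ℚ.+ g zero) ℚ.+ (sumℚ n (f ∘ suc) ℚ.+ sumℚ n (g ∘ suc))
    ≡⟨ interchange (f zero) (g zero) (sumℚ n (f ∘ suc)) (sumℚ n (g ∘ suc)) ⟩
  (f zero ℚ.+ sumℚ n (f ∘ suc)) ℚ.+ (g zero ℚ.+ sumℚ n (g ∘ suc)) ∎
  where
  open ≡-Reasoning
  open +-*-Solver
  interchange : ∀ a b c d → (a ℚ.+ b) ℚ.+ (c ℚ.+ d) ≡ (a ℚ.+ c) ℚ.+ (b ℚ.+ d)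
  interchange = solve 4 (λ a b c d → (a :+ b) :+ (c :+ d) := (a :+ c) :+ (b :+ d)) refl

sumℚ-ofℕ : ∀ n (c : Fin n → ℕ) → sumℚ n (ofℕ ∘ c) ≡ ofℕ (sumℕ n c)
sumℚ-ofℕ zero    c = refl
sumℚ-ofℕ (suc n) c = trans (cong (ofℕ (c zero) ℚ.+_) (sumℚ-ofℕ n (c ∘ suc)))
                            (sym (ofℕ-+ (c zero) (sumℕ n (c ∘ suc))))

sumℚ-½ : ∀ n → sumℚ n (λ _ → ½) ≡ + n ℚ./ 2
sumℚ-½ zero    = refl
sumℚ-½ (suc n) = trans (cong (½ ℚ.+_) (sumℚ-½ n)) (½+half n)

-- The capacity of an edge of weight w: how many pebbles a leaf behind that
-- edge may hold so that no single transfer delivers a pebble across it.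
capacity : ℚ → ℕ
capacity w with w ℚP.<? + 1 ℚ./ 3
... | yes _ = 3
... | no _ with w ℚP.<? ½
...   | yes _ = 2
...   | no _ with w ℚP.<? 1ℚ
...     | yes _ = 1
...     | no _  = 0

capacity-tight : ∀ w → w ℚ.* ofℕ (capacity w) ℚ.< 1ℚ
capacity-tight w with w ℚP.<? + 1 ℚ./ 3
... | yes w<⅓ = ℚP.*-monoˡ-<-pos (ofℕ 3) w<⅓
... | no _ with w ℚP.<? ½
...   | yes w<½ = ℚP.*-monoˡ-<-pos (ofℕ 2) w<½
...   | no _ with w ℚP.<? 1ℚ
...     | yes w<1 = ℚP.*-monoˡ-<-pos (ofℕ 1) w<1
...     | no _    = subst (ℚ._< 1ℚ) (sym (ℚP.*-zeroʳ w)) (ℚP.positive⁻¹ 1ℚ)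

capacity-blocks : ∀ w a → 0ℚ ℚ.≤ w → a ≤ capacity w → floorMul w a ≡ 0
capacity-blocks w a 0≤w a≤cap = floorMul-small w a 0≤w
  (ℚP.≤-<-trans (ℚP.*-monoˡ-≤-nonNeg w {{ℚ.nonNegative 0≤w}} (ofℕ-mono-≤ a≤cap))
                (capacity-tight w))

+-double-mono : ∀ c {v w} → v ℚ.≤ w → c ℚ.+ (v ℚ.+ v) ℚ.≤ c ℚ.+ (w ℚ.+ w)
+-double-mono c v≤w = ℚP.+-monoʳ-≤ c (ℚP.+-mono-≤ v≤w v≤w)

capacity-bound : ∀ w → 0ℚ ℚ.≤ w → ofℕ 2 ℚ.≤ ofℕ (capacity w) ℚ.+ (w ℚ.+ w)
capacity-bound w 0≤w with w ℚP.<? + 1 ℚ./ 3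
... | yes _ = ℚP.≤-trans (ℚP.<⇒≤ (*<* (ℤ.+<+ (ℕP.n<1+n 2)))) (+-double-mono (ofℕ 3) 0≤w)
... | no _ with w ℚP.<? ½
...   | yes _ = +-double-mono (ofℕ 2) 0≤w
...   | no w≮½ with w ℚP.<? 1ℚ
...     | yes _  = +-double-mono (ofℕ 1) (ℚP.≮⇒≥ w≮½)
...     | no w≮1 = +-double-mono (ofℕ 0) (ℚP.≮⇒≥ w≮1)

capacity-bound-strict : ∀ w → 0ℚ ℚ.≤ w → w ℚ.< ½ → ofℕ 2 ℚ.< ofℕ (capacity w) ℚ.+ (w ℚ.+ w)
capacity-bound-strict w 0≤w w<½ with w ℚP.<? + 1 ℚ./ 3
... | yes _ = ℚP.<-≤-trans (*<* (ℤ.+<+ (ℕP.n<1+n 2))) (+-double-mono (ofℕ 3) 0≤w)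
... | no w≮⅓ with w ℚP.<? ½
...   | yes _  = ℚP.<-≤-trans (*<* (ℤ.+<+ (ℕP.m≤n⇒m≤1+n (ℕP.≤-refl {7}))))   -- 2 < 2 + 2/3
                              (+-double-mono (ofℕ 2) (ℚP.≮⇒≥ w≮⅓))
...   | no w≮½ = ⊥-elim (w≮½ w<½)

-- Weights summing to k/2 with a light edge leave total capacity above k:
-- summing 2 ≤ cap(w) + 2w gives 2k < Σ cap + 2·(k/2).
capacity-total : ∀ k (W : Fin k → ℚ) → (∀ e → 0ℚ ℚ.≤ W e) → sumℚ k W ≡ + k ℚ./ 2 →
                 (j : Fin k) → W j ℚ.< ½ → k < sumℕ k (capacity ∘ W)
capacity-total k W 0≤W total j light = ℕP.+-cancelʳ-< k k Σcap (ofℕ-cancel-< 2k<Σcap+k)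
  where
  open ℚP.≤-Reasoning
  Σcap : ℕ
  Σcap = sumℕ k (capacity ∘ W)
  twos : sumℕ k (λ _ → 2) ≡ k + k
  twos = trans (sumℕ-const k 2) (trans (ℕP.*-comm k 2) (cong (k ℕ.+_) (ℕP.+-identityʳ k)))
  2k<Σcap+k : ofℕ (k + k) ℚ.< ofℕ (Σcap + k)
  2k<Σcap+k = begin-strict
    ofℕ (k + k)
      ≡⟨ cong ofℕ (sym twos) ⟩
    ofℕ (sumℕ k (λ _ → 2))
      ≡⟨ sym (sumℚ-ofℕ k (λ _ → 2)) ⟩
    sumℚ k (λ _ → ofℕ 2)
      <⟨ sumℚ-mono-< k _ _ (λ i → capacity-bound (W i) (0≤W i)) j
                           (capacity-bound-strict (W j) (0≤W j) light) ⟩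
    sumℚ k (λ i → ofℕ (capacity (W i)) ℚ.+ (W i ℚ.+ W i))
      ≡⟨ sumℚ-+ k (ofℕ ∘ capacity ∘ W) (λ i → W i ℚ.+ W i) ⟩
    sumℚ k (ofℕ ∘ capacity ∘ W) ℚ.+ sumℚ k (λ i → W i ℚ.+ W i)
      ≡⟨ cong₂ ℚ._+_ (sumℚ-ofℕ k (capacity ∘ W)) (sumℚ-+ k W W) ⟩
    ofℕ Σcap ℚ.+ (sumℚ k W ℚ.+ sumℚ k W)
      ≡⟨ cong (λ s → ofℕ Σcap ℚ.+ (s ℚ.+ s)) total ⟩
    ofℕ Σcap ℚ.+ (+ k ℚ./ 2 ℚ.+ + k ℚ./ 2)
      ≡⟨ cong (ofℕ Σcap ℚ.+_) (half+half k) ⟩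
    ofℕ Σcap ℚ.+ ofℕ k
      ≡⟨ sym (ofℕ-+ Σcap k) ⟩
    ofℕ (Σcap + k) ∎

all-half : ∀ k (W : Fin k → ℚ) → sumℚ k W ≡ + k ℚ./ 2 → (∀ e → ¬ W e ℚ.< ½) →
           ∀ e → W e ≡ ½
all-half k W total none e with W e ℚP.≤? ½
... | yes We≤½ = ℚP.≤-antisym We≤½ (ℚP.≮⇒≥ (none e))
... | no We≰½  = ⊥-elim (ℚP.<-irrefl (trans (sumℚ-½ k) (sym total))
                   (sumℚ-mono-< k (λ _ → ½) W (ℚP.≮⇒≥ ∘ none) e (ℚP.≰⇒> We≰½)))

sumℕ-punchIn : ∀ n (f : Fin (suc n) → ℕ) j → sumℕ (suc n) f ≡ f j + sumℕ n (f ∘ punchIn j)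
sumℕ-punchIn n       f zero    = refl
sumℕ-punchIn (suc n) f (suc j) = begin
  f zero + sumℕ (suc n) (f ∘ suc)          ≡⟨ cong (f zero ℕ.+_) (sumℕ-punchIn n (f ∘ suc) j) ⟩
  f zero + (f (suc j) + rest)              ≡⟨ sym (ℕP.+-assoc (f zero) (f (suc j)) rest) ⟩
  (f zero + f (suc j)) + rest              ≡⟨ cong (_+ rest) (ℕP.+-comm (f zero) (f (suc j))) ⟩
  (f (suc j) + f zero) + rest              ≡⟨ ℕP.+-assoc (f (suc j)) (f zero) rest ⟩
  f (suc j) + (f zero + rest)              ∎
  where
  open ≡-Reasoning
  rest : ℕ
  rest = sumℕ n (f ∘ suc ∘ punchIn j)

shed : ∀ {a b c S} → c ≤ a → a + b ≤ c + S → b ≤ S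
shed {a} {b} {c} {S} c≤a a+b≤c+S = ℕP.+-cancelˡ-≤ a b S (ℕP.≤-trans a+b≤c+S (ℕP.+-monoˡ-≤ S c≤a))

pigeonhole : ∀ n (f : Fin n → ℕ) → suc n ≤ sumℕ n f → ∃ λ i → 2 ≤ f i
pigeonhole (suc n) f n+2≤Σ with 2 ≤? f zero
... | yes 2≤f₀ = zero , 2≤f₀
... | no 2≰f₀ with pigeonhole n (f ∘ suc) (shed (ℕP.≤-pred (ℕP.≰⇒> 2≰f₀)) n+2≤Σ)
...   | i , 2≤fᵢ = suc i , 2≤fᵢ

pigeonhole-twice : ∀ n (f : Fin n → ℕ) → 3 + n ≤ sumℕ n f →
                   (∃ λ i → 4 ≤ f i) ⊎ (∃₂ λ i i' → i ≢ i' × 2 ≤ f i × 2 ≤ f i')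
pigeonhole-twice (suc n) f n+4≤Σ with pigeonhole (suc n) f (ℕP.≤-trans (ℕP.m≤n+m (2 + n) 2) n+4≤Σ)
... | i , 2≤fᵢ with 4 ≤? f i
...   | yes 4≤fᵢ = inj₁ (i , 4≤fᵢ)
...   | no 4≰fᵢ with pigeonhole n (f ∘ punchIn i)
                       (shed (ℕP.≤-pred (ℕP.≰⇒> 4≰fᵢ)) (subst (3 + suc n ≤_) (sumℕ-punchIn n f i) n+4≤Σ))
...     | i' , 2≤fᵢ' = inj₂ (i , punchIn i i' , (λ i≡ → FinP.punchInᵢ≢i i i' (sym i≡)) , 2≤fᵢ , 2≤fᵢ')

below-of-size : ∀ n (c : Fin n → ℕ) q → q ≤ sumℕ n c →
                ∃ λ (x : Fin n → ℕ) → (∀ i → x i ≤ c i) × sumℕ n x ≡ q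
below-of-size zero    c q q≤0 = (λ ()) , (λ ()) , sym (ℕP.n≤0⇒n≡0 q≤0)
below-of-size (suc n) c q q≤Σ with below-of-size n (c ∘ suc) (q ∸ c zero) (ℕP.m≤n+o⇒m∸n≤o q (c zero) q≤Σ)
... | x , x≤c , Σx≡ = (λ { zero → c zero ⊓ q ; (suc i) → x i })
                    , (λ { zero → ℕP.m⊓n≤m (c zero) q ; (suc i) → x≤c i })
                    , trans (cong (c zero ⊓ q ℕ.+_) Σx≡) (ℕP.m⊓n+n∸m≡n (c zero) q)

Below : (G : Graph) → Config G → Config G → Set
Below G C D = ∀ x → C x ≤ D x

Below-trans : ∀ G {C D E} → Below G C D → Below G D E → Below G C E
Below-trans G C≤D D≤E x = ℕP.≤-trans (C≤D x) (D≤E x)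

module _ (G : Graph) (C : Config G) (u : Fin (n G)) (a : ℕ) (v : Fin (n G)) (b : ℕ) where

  update-target : v ≢ u → update G C u a v b v ≡ C v + b
  update-target v≢u with v ≟ v | v ≟ u
  ... | yes _   | yes v≡u = ⊥-elim (v≢u v≡u)
  ... | yes _   | no _    = refl
  ... | no v≢v  | _       = ⊥-elim (v≢v refl)

  update-target-≥ : b ≤ update G C u a v b v
  update-target-≥ with v ≟ v | v ≟ u
  ... | yes _  | yes _ = ℕP.m≤n+m b _
  ... | yes _  | no _  = ℕP.m≤n+m b _
  ... | no v≢v | _     = ⊥-elim (v≢v refl)

  update-source : u ≢ v → update G C u a v b u ≡ C u ∸ a
  update-source u≢v with u ≟ v | u ≟ u
  ... | yes u≡v | _      = ⊥-elim (u≢v u≡v)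
  ... | no _    | yes _  = refl
  ... | no _    | no u≢u = ⊥-elim (u≢u refl)

  update-other : ∀ x → x ≢ u → x ≢ v → update G C u a v b x ≡ C x
  update-other x x≢u x≢v with x ≟ v | x ≟ u
  ... | yes x≡v | _       = ⊥-elim (x≢v x≡v)
  ... | no _    | yes x≡u = ⊥-elim (x≢u x≡u)
  ... | no _    | no _    = refl

update-nothing : ∀ G C u a v → Below G (update G C u a v 0) C
update-nothing G C u a v x with x ≟ v | x ≟ u
... | yes _ | yes _ = ℕP.≤-trans (ℕP.≤-reflexive (ℕP.+-identityʳ _)) (ℕP.m∸n≤m _ a)
... | yes _ | no _  = ℕP.≤-reflexive (ℕP.+-identityʳ _)
... | no _  | yes _ = ℕP.m∸n≤m _ a
... | no _  | no _  = ℕP.≤-refl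

module StarMoves (k : ℕ) where

  G : Graph
  G = StarGraph k

  then : ∀ {C D t} → OStep G C D → OCanReach G D t → OCanReach G C t
  then s (C' , s* , reached) = C' , s ◅ s* , reached

  leaf-to-centre : ∀ C i → 2 ≤ C (suc i) → OStep G C (update G C (suc i) 2 zero 1)
  leaf-to-centre C i = ostep i (suc i) zero (inj₂ (refl , refl))

  centre-to-leaf : ∀ C i → 2 ≤ C zero → OStep G C (update G C zero 2 (suc i) 1)
  centre-to-leaf C i = ostep i zero (suc i) (inj₁ (refl , refl))

  reach-centre : ∀ C i → 2 ≤ C (suc i) → OCanReach G C zero
  reach-centre C i 2≤Cᵢ = _ , leaf-to-centre C i 2≤Cᵢ ◅ ε , update-target-≥ G C (suc i) 2 zero 1

  reach-from-centre : ∀ C j → 2 ≤ C zero → OCanReach G C (suc j)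
  reach-from-centre C j 2≤C₀ = _ , centre-to-leaf C j 2≤C₀ ◅ ε , update-target-≥ G C zero 2 (suc j) 1

  fed-centre : ∀ C i → update G C (suc i) 2 zero 1 zero ≡ suc (C zero)
  fed-centre C i = trans (update-target G C (suc i) 2 zero 1 (λ ())) (ℕP.+-comm (C zero) 1)

  reach-via-centre : ∀ C j i → 1 ≤ C zero → 2 ≤ C (suc i) → OCanReach G C (suc j)
  reach-via-centre C j i 1≤C₀ 2≤Cᵢ = then (leaf-to-centre C i 2≤Cᵢ)
    (reach-from-centre _ j (subst (2 ≤_) (sym (fed-centre C i)) (s≤s 1≤C₀)))

  reach-via-two-leaves : ∀ C j i i' → i ≢ i' → 2 ≤ C (suc i) → 2 ≤ C (suc i') → OCanReach G C (suc j)
  reach-via-two-leaves C j i i' i≢i' 2≤Cᵢ 2≤Cᵢ' = then (leaf-to-centre C i 2≤Cᵢ)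
    (reach-via-centre _ j i' (subst (1 ≤_) (sym (fed-centre C i)) (s≤s z≤n))
      (subst (2 ≤_) (sym (update-other G C (suc i) 2 zero 1 (suc i')
                                        (λ i'≡i → i≢i' (sym (FinP.suc-injective i'≡i))) (λ ())))
             2≤Cᵢ'))

  reach-via-big-leaf : ∀ C j i → 4 ≤ C (suc i) → OCanReach G C (suc j)
  reach-via-big-leaf C j i 4≤Cᵢ = then (leaf-to-centre C i (ℕP.≤-trans (ℕP.m≤m+n 2 2) 4≤Cᵢ))
    (reach-via-centre _ j i (subst (1 ≤_) (sym (fed-centre C i)) (s≤s z≤n))
      (subst (2 ≤_) (sym (update-source G C (suc i) 2 zero 1 (λ ()))) (ℕP.∸-monoˡ-≤ 2 4≤Cᵢ)))

leaves-hold : ∀ c L m → c ≤ 1 → c + L ≡ m + 2 → suc m ≤ L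
leaves-hold c L m c≤1 c+L≡ = shed c≤1 (subst (_≤ c + L) (ℕP.+-comm m 2) (ℕP.≤-reflexive (sym c+L≡)))

-- For the centre, the leaves hold
-- k + 3 > k + 1 pebbles, so some leaf feeds it.  For an empty leaf j, by the
-- centre's content: two or more feed j directly; one is completed to two by a
-- leaf; none leaves k + 3 pebbles on the other k leaves, hence one leaf with
-- four or two leaves with two each, each way bringing two pebbles to the centre.
star-solvable : ∀ k → OSolvable (StarGraph (suc k)) (suc k + 2)
star-solvable k C size≡ t with 1 ≤? C t
... | yes occupied = C , ε , occupied
star-solvable k C size≡ zero | no empty with pigeonhole (suc k) (C ∘ suc)
    (leaves-hold (C zero) _ (suc k) (ℕP.≤-trans (ℕP.≮⇒≥ empty) z≤n) size≡)
... | i , 2≤Cᵢ = StarMoves.reach-centre (suc k) C i 2≤Cᵢ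
star-solvable k C size≡ (suc j) | no empty with C zero in centre
... | suc (suc _) = StarMoves.reach-from-centre (suc k) C j (subst (2 ≤_) (sym centre) (s≤s (s≤s z≤n)))
... | 1 with pigeonhole (suc k) (C ∘ suc)
               (leaves-hold 1 _ (suc k) ℕP.≤-refl size≡)
...   | i , 2≤Cᵢ = StarMoves.reach-via-centre (suc k) C j i (ℕP.≤-reflexive (sym centre)) 2≤Cᵢ
star-solvable k C size≡ (suc j) | no empty | 0 with pigeonhole-twice k (C ∘ suc ∘ punchIn j) others-hold
  where
  others-hold : 3 + k ≤ sumℕ k (C ∘ suc ∘ punchIn j)
  others-hold = ℕP.≤-reflexive (begin
    3 + k                                    ≡⟨ cong suc (ℕP.+-comm 2 k) ⟩
    suc k + 2                                ≡⟨ sym size≡ ⟩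
    sumℕ (suc k) (C ∘ suc)                   ≡⟨ sumℕ-punchIn k (C ∘ suc) j ⟩
    C (suc j) + sumℕ k (C ∘ suc ∘ punchIn j) ≡⟨ cong (_+ sumℕ k (C ∘ suc ∘ punchIn j))
                                                     (ℕP.n<1⇒n≡0 (ℕP.≰⇒> empty)) ⟩
    sumℕ k (C ∘ suc ∘ punchIn j)             ∎)
    where open ≡-Reasoning
... | inj₁ (i , 4≤Cᵢ) = StarMoves.reach-via-big-leaf (suc k) C j (punchIn j i) 4≤Cᵢ
... | inj₂ (i , i' , i≢i' , 2≤Cᵢ , 2≤Cᵢ') =
  StarMoves.reach-via-two-leaves (suc k) C j (punchIn j i) (punchIn j i')
    (λ e → i≢i' (FinP.punchIn-injective j i i' e)) 2≤Cᵢ 2≤Cᵢ'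

-- Ordinary pebbling is weighted pebbling at weight ½ moving two pebbles at a
-- time, so the uniform weighting ½ inherits ordinary solvability.
ordinary-move-as-half : ∀ G {C D} → OStep G C D → WStep G (λ _ → ½) C D
ordinary-move-as-half G (ostep e u v along 2≤Cᵤ) = wstep e u v along 2 (s≤s z≤n) 2≤Cᵤ

ordinary-as-half : ∀ G {C D} → Star (OStep G) C D → Star (WStep G (λ _ → ½)) C D
ordinary-as-half G = map {T = OStep G} (ordinary-move-as-half G)

half-solvable : ∀ G p → OSolvable G p → WSolvable G (λ _ → ½) p
half-solvable G p solvable C size≡ t with solvable C size≡ t
... | C' , moves , reached = C' , ordinary-as-half G moves , reached

half-valid : ∀ G → ValidWeight G (λ _ → ½)
half-valid G = (λ _ → ℚP.<⇒≤ (ℚP.positive⁻¹ ½) , *≤* (ℤ.+≤+ (s≤s z≤n))) , sumℚ-½ (m G)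

-- Solvability for an arbitrary move relation; OSolvable and WSolvable are
-- its instances for ordinary and weighted moves.
SolvableBy : (G : Graph) → (Config G → Config G → Set) → ℕ → Set
SolvableBy G Step p =
  (C : Config G) → size G C ≡ p → (t : Fin (n G)) → ∃ λ C' → Star Step C C' × 1 ≤ C' t

invariant-along : ∀ G {Step : Config G → Config G → Set} (Inv : Config G → Set) →
                  (∀ {C D} → Step C D → Inv C → Inv D) →
                  ∀ {C D} → Star Step C D → Inv C → Inv D
invariant-along G Inv preserve = fold (λ C D → Inv C → Inv D) (λ s continue → continue ∘ preserve s) id

unsolvable-below : ∀ G {Step : Config G → Config G → Set} (Inv : Config G → Set) →
                   (∀ {C D} → Step C D → Inv C → Inv D) →
                   (t : Fin (n G)) → (∀ C → Inv C → C t ≤ 0) →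
                   (c : Config G) → (∀ X → Below G X c → Inv X) →
                   ∀ q → q ≤ size G c → ¬ SolvableBy G Step q
unsolvable-below G Inv preserve t empty c below q q≤Σc solvable with below-of-size (n G) c q q≤Σc
... | X , X≤c , size≡ with solvable X size≡ t
...   | C' , moves , reached =
  ℕP.<-irrefl refl
    (ℕP.≤-trans reached (empty C' (invariant-along G Inv preserve moves (below X X≤c))))

Lossy : ℕ → ℕ → Set
Lossy a b = b ≤ 1 × (1 ≤ b → 2 ≤ a)

half-lossy : ∀ a → 1 ≤ a → a ≤ 3 → Lossy a (floorMul ½ a)
half-lossy 1 _ _ = z≤n , λ ()
half-lossy 2 _ _ = ℕP.≤-refl , λ _ → ℕP.≤-refl
half-lossy 3 _ _ = ℕP.≤-refl , λ _ → s≤s (s≤s z≤n)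
half-lossy (suc (suc (suc (suc _)))) _ (s≤s (s≤s (s≤s ())))

-- The star with k + 2 leaves t, s, … cannot be pebbled to the leaf t by
-- lossy transfers from a configuration below `before' (t empty, three
-- pebbles on s, one on every other leaf): one transfer s → centre reaches
-- `after', where nothing holds two pebbles any more.
module Blocking (k : ℕ) where

  G : Graph
  G = StarGraph (suc (suc k))

  t s : Fin (3 + k)
  t = suc zero
  s = suc (suc zero)

  before after : Config G
  before zero                    = 0
  before (suc zero)              = 0
  before (suc (suc zero))        = 3
  before (suc (suc (suc _)))     = 1
  after zero                     = 1
  after (suc zero)               = 0
  after (suc (suc zero))         = 1
  after (suc (suc (suc _)))      = 1

  Blocked : Config G → Set
  Blocked C = Below G C before ⊎ Below G C after

  blocked-down : ∀ {C D} → Below G D C → Blocked C → Blocked D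
  blocked-down D≤C (inj₁ C≤) = inj₁ (Below-trans G D≤C C≤)
  blocked-down D≤C (inj₂ C≤) = inj₂ (Below-trans G D≤C C≤)

  blocked-≤3 : ∀ C → Blocked C → ∀ x → C x ≤ 3
  blocked-≤3 C (inj₁ C≤) x = ℕP.≤-trans (C≤ x) (before-≤3 x)
    where
    before-≤3 : ∀ x → before x ≤ 3
    before-≤3 zero                = z≤n
    before-≤3 (suc zero)          = z≤n
    before-≤3 (suc (suc zero))    = ℕP.≤-refl
    before-≤3 (suc (suc (suc _))) = s≤s z≤n
  blocked-≤3 C (inj₂ C≤) x = ℕP.≤-trans (C≤ x) (after-≤3 x)
    where
    after-≤3 : ∀ x → after x ≤ 3
    after-≤3 zero                = s≤s z≤n
    after-≤3 (suc zero)          = z≤n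
    after-≤3 (suc (suc zero))    = s≤s z≤n
    after-≤3 (suc (suc (suc _))) = s≤s z≤n

  before-big : ∀ x → 2 ≤ before x → x ≡ s
  before-big (suc (suc zero)) _ = refl
  before-big zero                ()
  before-big (suc zero)          ()
  before-big (suc (suc (suc _))) (s≤s ())

  after-small : ∀ x → ¬ 2 ≤ after x
  after-small zero                (s≤s ())
  after-small (suc zero)          ()
  after-small (suc (suc zero))    (s≤s ())
  after-small (suc (suc (suc _))) (s≤s ())

  spend-s : ∀ C a → Below G C before → 2 ≤ a → Below G (update G C s a zero 1) after
  spend-s C a C≤ 2≤a zero = subst (_≤ 1) (sym (update-target G C s a zero 1 (λ ())))
                                  (ℕP.+-monoˡ-≤ 1 (C≤ zero))
  spend-s C a C≤ 2≤a (suc (suc zero)) = subst (_≤ 1) (sym (update-source G C s a zero 1 (λ ())))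
                                            (ℕP.∸-mono (C≤ s) 2≤a)
  spend-s C a C≤ 2≤a x@(suc zero) =
    subst (_≤ 0) (sym (update-other G C s a zero 1 x (λ ()) (λ ()))) (C≤ x)
  spend-s C a C≤ 2≤a x@(suc (suc (suc _))) =
    subst (_≤ 1) (sym (update-other G C s a zero 1 x (λ ()) (λ ()))) (C≤ x)

  -- Lossy transfers preserve it: a transfer delivering nothing only removes
  -- pebbles, and one delivering a pebble needs two on its source, i.e. s.
  blocked-step : ∀ C e u v a b → Along G e u v → 1 ≤ a → a ≤ C u → Lossy a b →
                 Blocked C → Blocked (update G C u a v b)
  blocked-step C e u v a 0 _ _ _ _ blocked = blocked-down (update-nothing G C u a v) blocked
  blocked-step C e u v a (suc (suc _)) _ _ _ (s≤s () , _)
  blocked-step C e u v a 1 _ _ a≤Cᵤ (_ , 2≤a) (inj₂ C≤) =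
    ⊥-elim (after-small u (ℕP.≤-trans (2≤a (s≤s z≤n)) (ℕP.≤-trans a≤Cᵤ (C≤ u))))
  blocked-step C e u v a 1 along _ a≤Cᵤ (_ , 2≤a) (inj₁ C≤)
    with before-big u (ℕP.≤-trans (2≤a (s≤s z≤n)) (ℕP.≤-trans a≤Cᵤ (C≤ u)))
  ... | refl with along
  ...   | inj₁ (() , _)
  ...   | inj₂ (refl , refl) = inj₂ (spend-s C a C≤ (2≤a (s≤s z≤n)))

  blocked-empty : ∀ C → Blocked C → C t ≤ 0
  blocked-empty C (inj₁ C≤) = C≤ t
  blocked-empty C (inj₂ C≤) = C≤ t

  fits-before : ∀ q → q < suc (suc k) + 2 → q ≤ size G before
  fits-before q q< = ℕP.≤-pred (subst (q <_) total q<)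
    where
    total : suc (suc k) + 2 ≡ suc (size G before)
    total = begin
      suc (suc k) + 2             ≡⟨ cong (2 ℕ.+_) (ℕP.+-comm k 2) ⟩
      4 + k                       ≡⟨ cong (4 ℕ.+_) (sym (trans (sumℕ-const k 1) (ℕP.*-identityʳ k))) ⟩
      4 + sumℕ k (λ _ → 1)        ∎
      where open ≡-Reasoning

  -- Ordinary moves transfer two pebbles and deliver one: lossy.
  ordinary-unsolvable : ∀ q → q < suc (suc k) + 2 → ¬ OSolvable G q
  ordinary-unsolvable q q< =
    unsolvable-below G Blocked ordinary-step t blocked-empty before (λ _ → inj₁) q (fits-before q q<)
    where
    ordinary-step : ∀ {C D} → OStep G C D → Blocked C → Blocked D
    ordinary-step (ostep e u v along 2≤Cᵤ) =
      blocked-step _ e u v 2 1 along (s≤s z≤n) 2≤Cᵤ (ℕP.≤-refl , λ _ → ℕP.≤-refl)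

  -- At weight ½ every transfer is lossy, since no vertex holds four pebbles.
  half-unsolvable : ∀ W → (∀ e → W e ≡ ½) → ∀ q → q < suc (suc k) + 2 → ¬ WSolvable G W q
  half-unsolvable W half q q< =
    unsolvable-below G Blocked half-step t blocked-empty before (λ _ → inj₁) q (fits-before q q<)
    where
    half-step : ∀ {C D} → WStep G W C D → Blocked C → Blocked D
    half-step {C} (wstep e u v along a 1≤a a≤Cᵤ) blocked =
      subst (λ w → Blocked (update G C u a v (floorMul w a))) (sym (half e))
        (blocked-step C e u v a _ along 1≤a a≤Cᵤ
          (half-lossy a 1≤a (ℕP.≤-trans a≤Cᵤ (blocked-≤3 C blocked u))) blocked)

-- A light edge (weight below ½) leaves room for k + 1 pebbles on the leaves
-- of the star with k leaves such that nothing ever reaches the centre: each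
-- leaf holds at most the capacity of its edge.
module Capping (k : ℕ) (W : Fin k → ℚ) (0≤W : ∀ e → 0ℚ ℚ.≤ W e) where

  G : Graph
  G = StarGraph k

  profile : Config G
  profile zero    = 0
  profile (suc i) = capacity (W i)

  -- Below the profile the centre is empty, so moves start at a leaf and
  -- deliver nothing, which keeps the configuration below the profile.
  capped-step : ∀ {C D} → WStep G W C D → Below G C profile → Below G D profile
  capped-step (wstep e _ _ (inj₁ (refl , refl)) a 1≤a a≤C₀) C≤ =
    ⊥-elim (ℕP.<-irrefl refl (ℕP.≤-trans 1≤a (ℕP.≤-trans a≤C₀ (C≤ zero))))
  capped-step {C} (wstep e _ _ (inj₂ (refl , refl)) a 1≤a a≤Cₑ) C≤ =
    Below-trans G (subst (λ b → Below G (update G C (suc e) a zero b) C)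
                         (sym (capacity-blocks (W e) a (0≤W e) (ℕP.≤-trans a≤Cₑ (C≤ (suc e)))))
                         (update-nothing G C (suc e) a zero))
                  C≤

  -- With a light edge the profile holds more than k pebbles.
  light-unsolvable : sumℚ k W ≡ + k ℚ./ 2 → ∀ j → W j ℚ.< ½ →
                     ∀ q → q < k + 2 → ¬ WSolvable G W q
  light-unsolvable total j light q q< =
    unsolvable-below G (λ C → Below G C profile) capped-step zero (λ C C≤ → C≤ zero)
      profile (λ _ → id) q
      (ℕP.≤-trans (ℕP.≤-pred (subst (q <_) (ℕP.+-comm k 2) q<))
                  (capacity-total k W 0≤W total j light))

-- Every weighting of total weight k/2 either has a light edge or is uniformly ½.
weighted-unsolvable : ∀ k q → q < suc (suc k) + 2 →
                      ¬ WeightedSolvable (StarGraph (suc (suc k))) q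
weighted-unsolvable k q q< (W , (bounds , total) , solvable) with FinP.any? (λ e → W e ℚP.<? ½)
... | yes (j , light) =
  Capping.light-unsolvable (suc (suc k)) W (proj₁ ∘ bounds) total j light q q< solvable
... | no no-light =
  Blocking.half-unsolvable k W (all-half _ W total (λ e light → no-light (e , light))) q q< solvable

proposition8 : (k : ℕ) → 2 ≤ k →
    IsWeightedPebblingNumber (StarGraph k) (k + 2) × IsPebblingNumber (StarGraph k) (k + 2)
proposition8 (suc zero) (s≤s ())
proposition8 (suc (suc k)) _ =
  (s≤s z≤n , ((λ _ → ½) , half-valid G , half-solvable G _ solvable) ,
   (λ q _ → weighted-unsolvable k q)) ,
  (solvable , Blocking.ordinary-unsolvable k)
  where
  G : Graph
  G = StarGraph (suc (suc k))
  solvable : OSolvable G (suc (suc k) + 2)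
  solvable = star-solvable (suc k)
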